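{- Let $P$ be a trapezoid order on a finite ground set such that $P = X\cap L$, where $X$ is an interval order and $L$ is a linear order on the same ground set. Then $P$ is a proper parallelogram order.
   Context: The intersection $X\cap L$ of two orders on the same ground set is the order in which $x<y$ if and only if $x<y$ in both $X$ and $L$. A trapezoid representation uses two parallel baselines. Each element $x$ is assigned a closed interval $[l(x),r(x)]$ on the lower baseline and a closed interval $[L(x),R(x)]$ on the upper baseline, and its trapezoid $T_x$ is the convex hull of these two intervals. The representation requires $x\prec y$ if and only if $r(x)<l(y)$ and $R(x)<L(y)$. A proper parallelogram order is one having a trapezoid representation with two properties: - for each $x$, the upper and lower intervals of $x$ have equal length; - no trapezoid is properly contained in another. An interval order is an order representable by closed real intervals, with $x<y$ if and only if the interval of $x$ lies entirely to the left of the interval of $y$.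
   Formalization: The interval representation of $X$ and the trapezoid representation of $P$ have rational rather than real endpoints, and the proper parallelogram representation obtained for $P$ is taken in the rationals as well. -}

module Defs where

open import Level using (0ℓ)
open import Data.Nat using (ℕ)
open import Data.Fin using (Fin)
open import Data.Rational using (ℚ; _≤_; _<_; _-_)
open import Data.Product using (_×_; ∃)
open import Relation.Nullary using (¬_)
open import Relation.Binary.PropositionalEquality using (_≡_)
open import Relation.Binary.Structures using (IsStrictPartialOrder; IsStrictTotalOrder)

Rel : ℕ → Set₁
Rel n = Fin n → Fin n → Set

_∩ᵒ_ : ∀ {n} → Rel n → Rel n → Rel n
(X ∩ᵒ L) x y = X x y × L x y

_≐_ : ∀ {n} → Rel n → Rel n → Set
P ≐ Q = ∀ x y → (P x y → Q x y) × (Q x y → P x y)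

IsOrder : ∀ {n} → Rel n → Set
IsOrder P = IsStrictPartialOrder _≡_ P

IsLinearOrder : ∀ {n} → Rel n → Set
IsLinearOrder P = IsStrictTotalOrder _≡_ P

record IntervalRep {n : ℕ} (X : Rel n) : Set where
  field
    l r   : Fin n → ℚ
    l≤r   : ∀ x → l x ≤ r x
    rep   : ∀ x y → (X x y → r x < l y) × (r x < l y → X x y)

IsIntervalOrder : ∀ {n} → Rel n → Set
IsIntervalOrder X = IsOrder X × IntervalRep X

-- Trapezoid representation: lower interval [l x , r x], upper [L x , R x];
-- x ≺ y iff r x < l y and R x < L y.
record TrapezoidRep {n : ℕ} (P : Rel n) : Set where
  field
    l r L R : Fin n → ℚ
    l≤r     : ∀ x → l x ≤ r x
    L≤R     : ∀ x → L x ≤ R x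
    rep     : ∀ x y → (P x y → (r x < l y × R x < L y))
                    × ((r x < l y × R x < L y) → P x y)

IsTrapezoidOrder : ∀ {n} → Rel n → Set
IsTrapezoidOrder P = IsOrder P × TrapezoidRep P

-- T_x ⊆ T_y (convex hull of two intervals on parallel baselines: contained
-- iff both intervals are contained), and T_x ≠ T_y.
ProperlyContained : ∀ {n} {P : Rel n} → TrapezoidRep P → Fin n → Fin n → Set
ProperlyContained T x y =
  (l y ≤ l x × r x ≤ r y × L y ≤ L x × R x ≤ R y)
  × ¬ (l x ≡ l y × r x ≡ r y × L x ≡ L y × R x ≡ R y)
  where open TrapezoidRep T

IsProperParallelogramRep : ∀ {n} {P : Rel n} → TrapezoidRep P → Set
IsProperParallelogramRep {n} T =
  (∀ x → r x - l x ≡ R x - L x)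
  × (∀ (x y : Fin n) → ¬ ProperlyContained T x y)
  where open TrapezoidRep T

IsProperParallelogramOrder : ∀ {n} → Rel n → Set
IsProperParallelogramOrder P =
  IsOrder P × ∃ λ (T : TrapezoidRep P) → IsProperParallelogramRep T

{-# OPTIONS --safe #-}
-- Take the interval [l x, r x] of x in X as its lower interval, and the same
-- interval translated by c x as its upper one, where c increases along L in
-- steps larger than any difference of endpoints.  On the upper baseline the
-- translation dominates, so the upper interval of x lies left of that of y
-- exactly when x <_L y; hence x ≺ y iff x <_X y and x <_L y.  Both intervals
-- of x have the same length, and for x <_L y the upper interval of y starts
-- and ends strictly right of that of x, so no trapezoid contains another.
module Submission where

open import Defs
open import Data.Nat using (ℕ; zero; suc)
open import Data.Fin using (Fin; zero; suc)
open import Data.Rational using (ℚ; _≤_; _<_; _-_; _+_; _⊔_; _⊓_; 0ℚ; 1ℚ; +-0-rawMonoid)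
open import Data.Rational.Properties
open import Data.Rational.Solver using (module +-*-Solver)
open import Algebra.Definitions.RawMonoid +-0-rawMonoid using (sum)
open import Data.Product using (_×_; _,_; ∃; proj₁; proj₂)
open import Data.Empty using (⊥-elim)
open import Function using (_∘_)
open import Relation.Nullary using (¬_; Dec; yes; no)
open import Relation.Binary.PropositionalEquality using (_≡_; refl)
open import Relation.Binary.Definitions using (Trichotomous; tri<; tri≈; tri>)
open import Relation.Binary.Structures using (IsStrictTotalOrder)

open +-*-Solver

<⇒≱ : ∀ {p q} → p < q → ¬ q ≤ p
<⇒≱ p<q q≤p = <-irrefl refl (<-≤-trans p<q q≤p)

p<p+1 : ∀ p → p < p + 1ℚ
p<p+1 p = begin-strict
  p         ≡⟨ +-identityʳ p ⟨
  p + 0ℚ    <⟨ +-monoʳ-< p (positive⁻¹ 1ℚ) ⟩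
  p + 1ℚ    ∎
  where open ≤-Reasoning

sum-mono-≤ : ∀ {n} {f g : Fin n → ℚ} → (∀ i → f i ≤ g i) → sum f ≤ sum g
sum-mono-≤ {zero}  _   = ≤-refl
sum-mono-≤ {suc n} f≤g = +-mono-≤ (f≤g zero) (sum-mono-≤ (f≤g ∘ suc))

pointwise-gap⇒sum-gap : ∀ {n} {f g : Fin n → ℚ} {K} → (∀ i → f i ≤ g i) →
                        (j : Fin n) → f j + K ≤ g j → sum f + K ≤ sum g
pointwise-gap⇒sum-gap {suc n} {f} {g} {K} f≤g zero fj+K≤gj = begin
  f zero + sum (f ∘ suc) + K    ≡⟨ solve 3 (λ a s k → a :+ s :+ k := a :+ k :+ s) refl (f zero) (sum (f ∘ suc)) K ⟩
  f zero + K + sum (f ∘ suc)    ≤⟨ +-mono-≤ fj+K≤gj (sum-mono-≤ (f≤g ∘ suc)) ⟩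
  g zero + sum (g ∘ suc)        ∎
  where open ≤-Reasoning
pointwise-gap⇒sum-gap {suc n} {f} {g} {K} f≤g (suc j) fj+K≤gj = begin
  f zero + sum (f ∘ suc) + K    ≡⟨ +-assoc (f zero) (sum (f ∘ suc)) K ⟩
  f zero + (sum (f ∘ suc) + K)  ≤⟨ +-mono-≤ (f≤g zero) (pointwise-gap⇒sum-gap (f≤g ∘ suc) j fj+K≤gj) ⟩
  g zero + sum (g ∘ suc)        ∎
  where open ≤-Reasoning

upper-bound : ∀ {n} (f : Fin n → ℚ) → ∃ λ M → 0ℚ ≤ M × (∀ i → f i ≤ M)
upper-bound {zero}  f = 0ℚ , ≤-refl , λ ()
upper-bound {suc n} f with upper-bound (f ∘ suc)
... | M , 0≤M , f≤M = f zero ⊔ M , p≤q⇒p≤r⊔q (f zero) 0≤M , λ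
  { zero    → p≤p⊔q (f zero) M
  ; (suc i) → p≤q⇒p≤r⊔q (f zero) (f≤M i)
  }

lower-bound : ∀ {n} (f : Fin n → ℚ) → ∃ λ m → m ≤ 0ℚ × (∀ i → m ≤ f i)
lower-bound {zero}  f = 0ℚ , ≤-refl , λ ()
lower-bound {suc n} f with lower-bound (f ∘ suc)
... | m , m≤0 , m≤f = f zero ⊓ m , p≤q⇒r⊓p≤q (f zero) m≤0 , λ
  { zero    → p⊓q≤p (f zero) m
  ; (suc i) → p≤q⇒r⊓p≤q (f zero) (m≤f i)
  }

gap-constant : ∀ {n} (f g : Fin n → ℚ) → ∃ λ K → 0ℚ ≤ K × (∀ x y → f x < g y + K)
gap-constant f g with upper-bound f | lower-bound g
... | M , 0≤M , f≤M | m , m≤0 , m≤g = K , 0≤K , f<g+K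
  where
  open ≤-Reasoning
  K : ℚ
  K = M - m + 1ℚ

  0≤K : 0ℚ ≤ K
  0≤K = begin
    0ℚ           ≤⟨ 0≤M ⟩
    M            ≡⟨ +-identityʳ M ⟨
    M - 0ℚ       ≤⟨ +-monoʳ-≤ M (neg-antimono-≤ m≤0) ⟩
    M - m        <⟨ p<p+1 (M - m) ⟩
    K            ∎

  f<g+K : ∀ x y → f x < g y + K
  f<g+K x y = begin-strict
    f x          ≤⟨ f≤M x ⟩
    M            ≡⟨ solve 2 (λ M m → M := m :+ (M :- m)) refl M m ⟩
    m + (M - m)  <⟨ +-monoʳ-< m (p<p+1 (M - m)) ⟩
    m + K        ≤⟨ +-monoˡ-≤ K (m≤g y) ⟩
    g y + K      ∎

weight : ∀ {A : Set} → ℚ → Dec A → ℚ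
weight K (yes _) = K
weight K (no _)  = 0ℚ

weight-mono : ∀ {A B : Set} {K} → 0ℚ ≤ K → (A → B) →
              (a : Dec A) (b : Dec B) → weight K a ≤ weight K b
weight-mono _   _   (yes _) (yes _) = ≤-refl
weight-mono _   A→B (yes a) (no ¬b) = ⊥-elim (¬b (A→B a))
weight-mono 0≤K _   (no _)  (yes _) = 0≤K
weight-mono _   _   (no _)  (no _)  = ≤-refl

spaced-embedding : ∀ {n} {L : Rel n} → IsStrictTotalOrder _≡_ L → ∀ {K} → 0ℚ ≤ K →
                   ∃ λ (c : Fin n → ℚ) → ∀ {x y} → L x y → c x + K ≤ c y
spaced-embedding {n} {L} L-total {K} 0≤K = c , spaced
  where
  open IsStrictTotalOrder L-total using (trans; irrefl) renaming (_<?_ to _<ᴸ?_)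

  c : Fin n → ℚ
  c x = sum λ z → weight K (z <ᴸ? x)

  spaced : ∀ {x y} → L x y → c x + K ≤ c y
  spaced {x} {y} x<y = pointwise-gap⇒sum-gap
    (λ z → weight-mono 0≤K (λ z<x → trans z<x x<y) (z <ᴸ? x) (z <ᴸ? y)) x (gain (x <ᴸ? x) (x <ᴸ? y))
    where
    gain : (a : Dec (L x x)) (b : Dec (L x y)) → weight K a + K ≤ weight K b
    gain (yes x<x) _         = ⊥-elim (irrefl refl x<x)
    gain (no _)    (yes _)   = ≤-reflexive (+-identityˡ K)
    gain (no _)    (no x≮y)  = ⊥-elim (x≮y x<y)

module ShiftedIntervals {n} {X L : Rel n} (I : IntervalRep X) (compare : Trichotomous _≡_ L)
  {K : ℚ} (gap : ∀ x y → IntervalRep.r I x < IntervalRep.l I y + K)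
  {c : Fin n → ℚ} (spaced : ∀ {x y} → L x y → c x + K ≤ c y) where

  open IntervalRep I

  l<l+K : ∀ x y → l x < l y + K
  l<l+K x y = ≤-<-trans (l≤r x) (gap x y)

  r<r+K : ∀ x y → r x < r y + K
  r<r+K x y = <-≤-trans (gap x y) (+-monoˡ-≤ K (l≤r y))

  l<r+K : ∀ x y → l x < r y + K
  l<r+K x y = ≤-<-trans (l≤r x) (r<r+K x y)

  shifted-< : ∀ {x y u v} → L x y → u < v + K → c x + u < c y + v
  shifted-< {x} {y} {u} {v} x<y u<v+K = begin-strict
    c x + u          <⟨ +-monoʳ-< (c x) u<v+K ⟩
    c x + (v + K)    ≡⟨ solve 3 (λ c v k → c :+ (v :+ k) := c :+ k :+ v) refl (c x) v K ⟩
    c x + K + v      ≤⟨ +-monoˡ-≤ v (spaced x<y) ⟩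
    c y + v          ∎
    where open ≤-Reasoning

  trapezoidRep : ∀ {P} → P ≐ (X ∩ᵒ L) → TrapezoidRep P
  trapezoidRep {P} P≐X∩L = record
    { l = l ; r = r ; L = λ x → c x + l x ; R = λ x → c x + r x
    ; l≤r = l≤r
    ; L≤R = λ x → +-monoʳ-≤ (c x) (l≤r x)
    ; rep = λ x y → represents x y , represented x y
    }
    where
    represents : ∀ x y → P x y → r x < l y × c x + r x < c y + l y
    represents x y Pxy with proj₁ (P≐X∩L x y) Pxy
    ... | Xxy , x<y = proj₁ (rep x y) Xxy , shifted-< x<y (gap x y)

    represented : ∀ x y → r x < l y × c x + r x < c y + l y → P x y
    represented x y (rx<ly , upper<) = proj₂ (P≐X∩L x y) (proj₂ (rep x y) rx<ly , x<y)
      where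
      x<y : L x y
      x<y with compare x y
      ... | tri< x<y _ _    = x<y
      ... | tri≈ _ refl _   = ⊥-elim (<⇒≱ rx<ly (l≤r x))
      ... | tri> _ _ y<x    = ⊥-elim (<-asym upper< (shifted-< y<x (l<r+K y x)))

  isProperParallelogramRep : ∀ {P} (P≐X∩L : P ≐ (X ∩ᵒ L)) →
                             IsProperParallelogramRep (trapezoidRep P≐X∩L)
  isProperParallelogramRep P≐X∩L = equal-lengths , not-properly-contained
    where
    equal-lengths : ∀ x → r x - l x ≡ (c x + r x) - (c x + l x)
    equal-lengths x = solve 3 (λ c r l → r :- l := (c :+ r) :- (c :+ l)) refl (c x) (r x) (l x)

    not-properly-contained : ∀ x y → ¬ ProperlyContained (trapezoidRep P≐X∩L) x y
    not-properly-contained x y ((_ , _ , Ly≤Lx , Rx≤Ry) , ≢) with compare x y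
    ... | tri< x<y _ _  = <⇒≱ (shifted-< x<y (l<l+K x y)) Ly≤Lx
    ... | tri≈ _ refl _ = ≢ (refl , refl , refl , refl)
    ... | tri> _ _ y<x  = <⇒≱ (shifted-< y<x (r<r+K y x)) Rx≤Ry

lemma6 : (n : ℕ) (P X L : Rel n)
    → IsTrapezoidOrder P
    → IsIntervalOrder X
    → IsLinearOrder L
    → P ≐ (X ∩ᵒ L)
    → IsProperParallelogramOrder P
lemma6 n P X L (isOrderP , _) (_ , I) L-total P≐X∩L =
  let open IntervalRep I using (l; r)
      (K , 0≤K , gap) = gap-constant r l
      (c , spaced)    = spaced-embedding L-total 0≤K
      open ShiftedIntervals I (IsStrictTotalOrder.compare L-total) gap spaced
  in isOrderP , trapezoidRep P≐X∩L , isProperParallelogramRep P≐X∩L
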